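{- Let $(a_n)_{n\ge1}$ be defined by $a_1=1$ and $a_n=a_{n-1}+\operatorname{lcm}(n,a_{n-1})$ for $n\ge2$, and for $n\ge2$ let $b_n=\frac{n}{\gcd(n,a_{n-1})}$. For a prime $p$ and $m\ge1$ let $S^{(1)}_p(m)=\#\{q\le m:\ q\in\mathbb{P},\ q\ne 3,\ q\equiv -1 \pmod p\}$, for $n\ge 2$ let $\delta^{(1)}_p(n)=\max\{0,\ v_p(n)-S^{(1)}_p(n-1)\}$, and let $B^{(1)}_n=\prod_p p^{\delta^{(1)}_p(n)}$. If $n\ge2$ satisfies $\sum_p\delta^{(1)}_p(n)\le 1$, then $B^{(1)}_n\in\{1\}\cup\mathbb{P}$, and consequently $b_n\in\{1\}\cup\mathbb{P}$.
   Context: $\mathbb{P}$ denotes the set of primes and $v_p(n)$ the $p$-adic valuation of $n$. Sums and products over $p$ range over all primes. -}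

module Defs where

open import Data.Nat using (ℕ; zero; suc; _+_; _*_; _∸_; _^_; _≤_; NonZero; ≢-nonZero; _≟_)
open import Data.Nat.DivMod using (_/_)
open import Data.Nat.Divisibility using (_∣?_)
open import Data.Nat.GCD using (gcd; gcd[m,n]≢0)
open import Data.Nat.LCM using (lcm)
open import Data.Nat.Primality using (prime?)
open import Data.List using (List; length; filter; upTo; map)
open import Data.Nat.ListAction using (sum; product)
open import Data.Sum using (inj₁)
open import Data.Product using (_×_)
open import Relation.Nullary using (¬_; does)
open import Relation.Nullary.Decidable using (_×-dec_; ¬?)
open import Data.Bool using (if_then_else_)
open import Relation.Binary.PropositionalEquality using (_≡_)

-- a 1 = 1, a n = a (n-1) + lcm n (a (n-1)) for n ≥ 2; a 0 = 0 is a junk value (unused).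
a : ℕ → ℕ
a zero = 0
a (suc zero) = 1
a (suc (suc k)) = a (suc k) + lcm (suc (suc k)) (a (suc k))

-- b n = n / gcd n (a (n-1)) for n ≥ 2; junk value 0 for n < 2 (unused).
b : ℕ → ℕ
b zero = 0
b (suc zero) = 0
b (suc (suc k)) = (suc (suc k) / gcd (suc (suc k)) (a (suc k)))
  {{≢-nonZero (gcd[m,n]≢0 (suc (suc k)) (a (suc k)) (inj₁ λ ()))}}

-- p-adic valuation v p n (fuel-based; exact for p ≥ 2 and n ≥ 1, fuel = n suffices).
-- Junk value 0 for p < 2 or n = 0.
vAux : ℕ → ℕ → ℕ → ℕ
vAux zero p n = 0
vAux (suc f) p n = if does (suc (suc p) ∣? n) then suc (vAux f p (n / suc (suc p))) else 0

v : ℕ → ℕ → ℕ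
v zero n = 0
v (suc zero) n = 0
v (suc (suc p)) zero = 0
v (suc (suc p)) n = vAux n p n

-- S⁽¹⁾_p(m) = #{ q ≤ m : q prime, q ≠ 3, q ≡ -1 (mod p) }   (q ≡ -1 mod p  ⇔  p ∣ q + 1)
S1 : ℕ → ℕ → ℕ
S1 p m = length (filter (λ q → prime? q ×-dec (¬? (q ≟ 3) ×-dec (p ∣? suc q))) (upTo (suc m)))

-- δ⁽¹⁾_p(n) = max{0, v_p(n) − S⁽¹⁾_p(n−1)}  (truncated subtraction)
δ1 : ℕ → ℕ → ℕ
δ1 p n = v p n ∸ S1 p (n ∸ 1)

-- primes p ≤ n (δ⁽¹⁾_p(n) = 0 for primes p > n ≥ 1, since then v_p(n) = 0)
primesUpTo : ℕ → List ℕ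
primesUpTo n = filter prime? (upTo (suc n))

sumδ1 : ℕ → ℕ
sumδ1 n = sum (map (λ p → δ1 p n) (primesUpTo n))

B1 : ℕ → ℕ
B1 n = product (map (λ p → p ^ δ1 p n) (primesUpTo n))

-- Since lcm(n, x) = x · (n / gcd(n, x)), the recurrence reads a_n = a_{n-1} (1 + b_n) with
-- b_n ∣ n. Hence a prime q > n + 1 never divides a_n, and a_n is even for n ≥ 3. For a prime
-- q ≥ 5 this gives gcd(q, a_{q-1}) = 1, i.e. b_q = q: q ∤ a_{q-2}, and q ∣ 1 + b_{q-1} would
-- force b_{q-1} = q - 1, i.e. gcd(q - 1, a_{q-2}) = 1, although both are even. So every prime
-- q ≤ m, q ≠ 3, with p ∣ q + 1 contributes the factor 1 + b_q = q + 1 to a_m, and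
-- p^{S⁽¹⁾_p(m)} ∣ a_m. If p^c ∣ b_n with c ≥ 1, then p^{S⁽¹⁾_p(n-1)} also divides
-- gcd(n, a_{n-1}) = n / b_n (induction on the exponent, using p ∣ b_n), so p^{c + S⁽¹⁾_p(n-1)} ∣ n
-- and c ≤ δ⁽¹⁾_p(n). Thus Σ_p δ⁽¹⁾_p(n) ≤ 1 leaves b_n at most one prime factor counted with
-- multiplicity, and B⁽¹⁾_n at most one factor p^{δ⁽¹⁾_p(n)} ≠ 1, namely p itself.
module Submission where

open import Data.Bool using (if_then_else_)
open import Data.Empty using (⊥-elim)
open import Data.List using ([]; _∷_; [_]; _++_; filter; length; map; upTo)
open import Data.List.Membership.Propositional using (_∈_)
open import Data.List.Membership.Propositional.Properties using (∈-filter⁺; ∈-upTo⁺)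
open import Data.List.Properties using (upTo-∷ʳ; filter-++; filter-accept; filter-reject; length-++)
open import Data.List.Relation.Unary.All using (All; []; _∷_)
open import Data.List.Relation.Unary.All.Properties using (all-filter)
open import Data.List.Relation.Unary.Any using (here; there)
open import Data.Nat
open import Data.Nat.DivMod
open import Data.Nat.Divisibility
open import Data.Nat.GCD
open import Data.Nat.LCM using (lcm; gcd*lcm)
open import Data.Nat.ListAction using (sum; product)
open import Data.Nat.Primality
open import Data.Nat.Primality.Factorisation using (factorise)
open import Data.Nat.Properties
open import Data.Product using (_×_; _,_; ∃₂)
open import Data.Sum using (_⊎_; inj₁; inj₂; [_,_]′) renaming (map to ⊎-map)
open import Function using (_∘_)
open import Relation.Binary.PropositionalEquality hiding ([_])
open import Relation.Nullary using (¬_; Dec; yes; no)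
open import Relation.Nullary.Decidable using (dec-true; _×-dec_; ¬?)
open import Relation.Unary using (Pred; Decidable)

open import Defs

lcm[m,n]≡n*[m/gcd[m,n]] : ∀ m n .{{_ : NonZero (gcd m n)}} → lcm m n ≡ n * (m / gcd m n)
lcm[m,n]≡n*[m/gcd[m,n]] m n = *-cancelʳ-≡ (lcm m n) (n * (m / gcd m n)) (gcd m n) (begin
  lcm m n * gcd m n        ≡⟨ *-comm (lcm m n) (gcd m n) ⟩
  gcd m n * lcm m n        ≡⟨ gcd*lcm m n ⟩
  m * n                    ≡⟨ *-comm m n ⟩
  n * m                    ≡⟨ cong (n *_) (m/n*n≡m (gcd[m,n]∣m m n)) ⟨
  n * (m / gcd m n * gcd m n) ≡⟨ *-assoc n (m / gcd m n) (gcd m n) ⟨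
  n * (m / gcd m n) * gcd m n ∎)
  where open ≡-Reasoning

2∣n⊎2∣1+n : ∀ n → 2 ∣ n ⊎ 2 ∣ suc n
2∣n⊎2∣1+n zero = inj₁ (divides 0 refl)
2∣n⊎2∣1+n (suc n) with 2∣n⊎2∣1+n n
... | inj₁ (divides q n≡q*2) = inj₂ (divides (suc q) (cong (suc ∘ suc) n≡q*2))
... | inj₂ 2∣1+n = inj₁ 2∣1+n

prime∤⇒gcd≡1 : ∀ {p n} → Prime p → ¬ p ∣ n → gcd p n ≡ 1
prime∤⇒gcd≡1 {p} {n} p-prime p∤n with prime⇒irreducible p-prime (gcd[m,n]∣m p n)
... | inj₁ gcd≡1 = gcd≡1
... | inj₂ gcd≡p = ⊥-elim (p∤n (subst (_∣ n) gcd≡p (gcd[m,n]∣n p n)))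

prime≢1 : ∀ {p} → Prime p → p ≢ 1
prime≢1 p-prime = nonTrivial⇒≢1 {{prime⇒nonTrivial p-prime}}

g : ℕ → ℕ
g k = gcd (2 + k) (a (1 + k))

g-nonZero : ∀ k → NonZero (g k)
g-nonZero k = ≢-nonZero (gcd[m,n]≢0 (2 + k) (a (1 + k)) (inj₁ λ ()))

b*g≡n : ∀ k → b (2 + k) * g k ≡ 2 + k
b*g≡n k = m/n*n≡m (gcd[m,n]∣m (2 + k) (a (1 + k)))
  where instance _ = g-nonZero k

b∣n : ∀ k → b (2 + k) ∣ 2 + k
b∣n k = divides (g k) (trans (sym (b*g≡n k)) (*-comm (b (2 + k)) (g k)))

b-nonZero : ∀ k → NonZero (b (2 + k))
b-nonZero k = ≢-nonZero λ b≡0 → 0≢1+n (trans (cong (_* g k) (sym b≡0)) (b*g≡n k))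

b≡n⇒g≡1 : ∀ k → b (2 + k) ≡ 2 + k → g k ≡ 1
b≡n⇒g≡1 k b≡n = *-cancelˡ-≡ (g k) 1 (2 + k) (begin
  (2 + k) * g k      ≡⟨ cong (_* g k) b≡n ⟨
  b (2 + k) * g k    ≡⟨ b*g≡n k ⟩
  2 + k              ≡⟨ *-identityʳ (2 + k) ⟨
  (2 + k) * 1        ∎)
  where open ≡-Reasoning

g≡1⇒b≡n : ∀ k → g k ≡ 1 → b (2 + k) ≡ 2 + k
g≡1⇒b≡n k g≡1 = begin
  b (2 + k)          ≡⟨ *-identityʳ (b (2 + k)) ⟨
  b (2 + k) * 1      ≡⟨ cong (b (2 + k) *_) g≡1 ⟨
  b (2 + k) * g k    ≡⟨ b*g≡n k ⟩
  2 + k              ∎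
  where open ≡-Reasoning

a-suc : ∀ k → a (2 + k) ≡ a (1 + k) * suc (b (2 + k))
a-suc k = begin
  A + lcm (2 + k) A  ≡⟨ cong (A +_) (lcm[m,n]≡n*[m/gcd[m,n]] (2 + k) A) ⟩
  A + A * b (2 + k)  ≡⟨ *-suc A (b (2 + k)) ⟨
  A * suc (b (2 + k)) ∎
  where open ≡-Reasoning
        A = a (1 + k)
        instance _ = g-nonZero k

b≤n : ∀ k → b (2 + k) ≤ 2 + k
b≤n k = ∣⇒≤ (b∣n k)

prime∤a : ∀ m {q} → Prime q → 2 + m < q → ¬ q ∣ a (1 + m)
prime∤a zero q-prime _ q∣1 = prime≢1 q-prime (∣1⇒≡1 q∣1)
prime∤a (suc m) {q} q-prime 3+m<q q∣a =
  [ prime∤a m q-prime (<-trans (n<1+n (2 + m)) 3+m<q)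
  , (λ q∣1+b → <⇒≱ 3+m<q (≤-trans (∣⇒≤ q∣1+b) (s≤s (b≤n m))))
  ]′ (euclidsLemma (a (1 + m)) (suc (b (2 + m))) q-prime (subst (q ∣_) (a-suc m) q∣a))

2∣a : ∀ m → 2 ∣ a (3 + m)
2∣a zero = divides 3 refl
2∣a (suc m) = subst (2 ∣_) (sym (a-suc (2 + m))) (∣m⇒∣m*n _ (2∣a m))

b[q]≡q : ∀ {q} → Prime q → q ≢ 3 → b q ≡ q
b[q]≡q {0} q-prime _ = ⊥-elim (NonTrivial.nonTrivial (prime⇒nonTrivial q-prime))
b[q]≡q {1} q-prime _ = ⊥-elim (prime≢1 q-prime refl)
b[q]≡q {2} q-prime _ = refl
b[q]≡q {3} q-prime q≢3 = ⊥-elim (q≢3 refl)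
b[q]≡q {4} q-prime _ = ⊥-elim (prime⇒¬composite q-prime composite[4])
b[q]≡q {suc (suc (suc (suc (suc j))))} q-prime _ =
  g≡1⇒b≡n (3 + j) (prime∤⇒gcd≡1 q-prime q∤a)
  where
  q = 5 + j
  2∣q-1 : 2 ∣ 4 + j
  2∣q-1 with 2∣n⊎2∣1+n (4 + j)
  ... | inj₁ 2∣q-1 = 2∣q-1
  ... | inj₂ 2∣q with prime⇒irreducible q-prime 2∣q
  ...   | inj₁ ()
  ...   | inj₂ ()
  q∤1+b : ¬ q ∣ suc (b (4 + j))
  q∤1+b q∣1+b = prime≢1 prime[2] (∣1⇒≡1 (subst (2 ∣_) g≡1 (gcd-greatest 2∣q-1 (2∣a j))))
    where
    g≡1 : g (2 + j) ≡ 1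
    g≡1 = b≡n⇒g≡1 (2 + j) (suc-injective (≤-antisym (s≤s (b≤n (2 + j))) (∣⇒≤ q∣1+b)))
  q∤a : ¬ q ∣ a (4 + j)
  q∤a q∣a = [ prime∤a (2 + j) q-prime ≤-refl , q∤1+b ]′
    (euclidsLemma (a (3 + j)) (suc (b (4 + j))) q-prime (subst (q ∣_) (a-suc (2 + j)) q∣a))

module _ {p} {P : Pred ℕ p} (P? : Decidable P) where

  count-upTo-suc : ∀ n → length (filter P? (upTo (suc n)))
                         ≡ length (filter P? (upTo n)) + length (filter P? [ n ])
  count-upTo-suc n = begin
    length (filter P? (upTo (suc n)))               ≡⟨ cong (length ∘ filter P?) (upTo-∷ʳ n) ⟨
    length (filter P? (upTo n ++ [ n ]))            ≡⟨ cong length (filter-++ P? (upTo n) [ n ]) ⟩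
    length (filter P? (upTo n) ++ filter P? [ n ])  ≡⟨ length-++ (filter P? (upTo n)) ⟩
    length (filter P? (upTo n)) + length (filter P? [ n ]) ∎
    where open ≡-Reasoning

  count-upTo-accept : ∀ {n} → P n → length (filter P? (upTo (suc n))) ≡ suc (length (filter P? (upTo n)))
  count-upTo-accept {n} Pn = begin
    length (filter P? (upTo (suc n)))  ≡⟨ count-upTo-suc n ⟩
    L + length (filter P? [ n ])       ≡⟨ cong ((L +_) ∘ length) (filter-accept P? Pn) ⟩
    L + 1                              ≡⟨ +-comm L 1 ⟩
    suc L                              ∎
    where open ≡-Reasoning
          L = length (filter P? (upTo n))

  count-upTo-reject : ∀ {n} → ¬ P n → length (filter P? (upTo (suc n))) ≡ length (filter P? (upTo n))
  count-upTo-reject {n} ¬Pn = begin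
    length (filter P? (upTo (suc n)))  ≡⟨ count-upTo-suc n ⟩
    L + length (filter P? [ n ])       ≡⟨ cong ((L +_) ∘ length) (filter-reject P? ¬Pn) ⟩
    L + 0                              ≡⟨ +-identityʳ L ⟩
    L                                  ∎
    where open ≡-Reasoning
          L = length (filter P? (upTo n))

Counted1 : ℕ → Pred ℕ _
Counted1 p q = Prime q × q ≢ 3 × p ∣ suc q

counted1? : ∀ p → Decidable (Counted1 p)
counted1? p q = prime? q ×-dec (¬? (q ≟ 3) ×-dec (p ∣? suc q))

p^S1∣a : ∀ p m → p ^ S1 p (suc m) ∣ a (suc m)
p^S1∣a p zero = 1∣ 1
p^S1∣a p (suc m) = by-cases (counted1? p (2 + m))
  where
  open ∣-Reasoning
  S = S1 p (1 + m)
  by-cases : Dec (Counted1 p (2 + m)) → p ^ S1 p (2 + m) ∣ a (2 + m)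
  by-cases (yes counted@(q-prime , q≢3 , p∣1+q)) = begin
    p ^ S1 p (2 + m)             ≡⟨ cong (p ^_) (count-upTo-accept (counted1? p) counted) ⟩
    p * p ^ S                    ∣⟨ *-pres-∣ p∣1+b (p^S1∣a p m) ⟩
    suc (b (2 + m)) * a (1 + m)  ≡⟨ *-comm (suc (b (2 + m))) (a (1 + m)) ⟩
    a (1 + m) * suc (b (2 + m))  ≡⟨ a-suc m ⟨
    a (2 + m)                    ∎
    where
    p∣1+b : p ∣ suc (b (2 + m))
    p∣1+b = subst (λ x → p ∣ suc x) (sym (b[q]≡q q-prime q≢3)) p∣1+q
  by-cases (no ¬counted) = begin
    p ^ S1 p (2 + m)             ≡⟨ cong (p ^_) (count-upTo-reject (counted1? p) ¬counted) ⟩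
    p ^ S                        ∣⟨ p^S1∣a p m ⟩
    a (1 + m)                    ∣⟨ m∣m*n (suc (b (2 + m))) ⟩
    a (1 + m) * suc (b (2 + m))  ≡⟨ a-suc m ⟨
    a (2 + m)                    ∎

p^j∣n⇒j≤vAux : ∀ {p} f j n {{_ : NonZero n}} → n ≤ f → (2 + p) ^ j ∣ n → j ≤ vAux f p n
p^j∣n⇒j≤vAux f zero n _ _ = z≤n
p^j∣n⇒j≤vAux zero (suc j) (suc n) () _
p^j∣n⇒j≤vAux {p} (suc f) (suc j) n n≤1+f p^[1+j]∣n = begin
  suc j                   ≤⟨ s≤s (p^j∣n⇒j≤vAux f j (n / P) n/P≤f P^j∣n/P) ⟩
  suc (vAux f p (n / P))  ≡⟨ vAux-step ⟨
  vAux (suc f) p n        ∎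
  where
  open ≤-Reasoning
  P = 2 + p
  P∣n : P ∣ n
  P∣n = m*n∣⇒m∣ P (P ^ j) p^[1+j]∣n
  P^j∣n/P : P ^ j ∣ n / P
  P^j∣n/P = m*n∣o⇒n∣o/m P (P ^ j) p^[1+j]∣n
  vAux-step : vAux (suc f) p n ≡ suc (vAux f p (n / P))
  vAux-step = cong (λ t → if t then suc (vAux f p (n / P)) else 0) (dec-true (P ∣? n) P∣n)
  instance
    n/P-nonZero : NonZero (n / P)
    n/P-nonZero = >-nonZero (m≥n⇒m/n>0 (∣⇒≤ P∣n))
  n/P≤f : n / P ≤ f
  n/P≤f = ≤-pred (≤-trans (m/n<m n P (s≤s (s≤s z≤n))) n≤1+f)

p^j∣n⇒j≤v : ∀ {p n j} {{_ : NonTrivial p}} {{_ : NonZero n}} → p ^ j ∣ n → j ≤ v p n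
p^j∣n⇒j≤v {suc (suc p)} {suc n} {j} = p^j∣n⇒j≤vAux (suc n) j (suc n) ≤-refl

p^j∣gcd : ∀ {p c m n} j → c * gcd m n ≡ m → p ∣ c → p ^ j ∣ n → p ^ j ∣ gcd m n
p^j∣gcd zero _ _ _ = 1∣ _
p^j∣gcd {p} {c} {m} {n} (suc j) c*gcd≡m p∣c p^[1+j]∣n = gcd-greatest p^[1+j]∣m p^[1+j]∣n
  where
  p^[1+j]∣m : p ^ suc j ∣ m
  p^[1+j]∣m = subst (p ^ suc j ∣_) c*gcd≡m
    (*-pres-∣ p∣c (p^j∣gcd j c*gcd≡m p∣c (m*n∣⇒n∣ p (p ^ j) p^[1+j]∣n)))

p^c∣b⇒c≤δ1 : ∀ {p} k c {{_ : NonTrivial p}} → p ^ c ∣ b (2 + k) → c ≤ δ1 p (2 + k)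
p^c∣b⇒c≤δ1 k zero _ = z≤n
p^c∣b⇒c≤δ1 {p} k (suc c) p^[1+c]∣b = m+n≤o⇒m≤o∸n (suc c) (p^j∣n⇒j≤v p^[1+c+S]∣n)
  where
  S = S1 p (1 + k)
  p^S∣g : p ^ S ∣ g k
  p^S∣g = p^j∣gcd S (b*g≡n k) (m*n∣⇒m∣ p (p ^ c) p^[1+c]∣b) (p^S1∣a p k)
  p^[1+c+S]∣n : p ^ (suc c + S) ∣ 2 + k
  p^[1+c+S]∣n = subst₂ _∣_ (sym (^-distribˡ-+-* p (suc c) S)) (b*g≡n k) (*-pres-∣ p^[1+c]∣b p^S∣g)

∈-primesUpTo⁺ : ∀ {p n} → Prime p → p ≤ n → p ∈ primesUpTo n
∈-primesUpTo⁺ p-prime p≤n = ∈-filter⁺ prime? (∈-upTo⁺ (s≤s p≤n)) p-prime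

module _ {A : Set} (f : A → ℕ) where

  ∈⇒≤sum-map : ∀ {x xs} → x ∈ xs → f x ≤ sum (map f xs)
  ∈⇒≤sum-map {xs = y ∷ ys} (here refl) = m≤m+n (f y) (sum (map f ys))
  ∈⇒≤sum-map {xs = y ∷ ys} (there x∈ys) = ≤-trans (∈⇒≤sum-map x∈ys) (m≤n+m _ (f y))

  ∈∧∈∧≢⇒+≤sum-map : ∀ {x z xs} → x ∈ xs → z ∈ xs → x ≢ z → f x + f z ≤ sum (map f xs)
  ∈∧∈∧≢⇒+≤sum-map (here refl) (here refl) x≢z = ⊥-elim (x≢z refl)
  ∈∧∈∧≢⇒+≤sum-map {xs = y ∷ ys} (here refl) (there z∈ys) _ = +-monoʳ-≤ (f y) (∈⇒≤sum-map z∈ys)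
  ∈∧∈∧≢⇒+≤sum-map {x} {xs = y ∷ ys} (there x∈ys) (here refl) _ = begin
    f x + f y            ≡⟨ +-comm (f x) (f y) ⟩
    f y + f x            ≤⟨ +-monoʳ-≤ (f y) (∈⇒≤sum-map x∈ys) ⟩
    f y + sum (map f ys) ∎
    where open ≤-Reasoning
  ∈∧∈∧≢⇒+≤sum-map {xs = y ∷ ys} (there x∈ys) (there z∈ys) x≢z =
    ≤-trans (∈∧∈∧≢⇒+≤sum-map x∈ys z∈ys x≢z) (m≤n+m _ (f y))

module _ (e : ℕ → ℕ) where

  sum-map≡0⇒product-pow≡1 : ∀ ps → sum (map e ps) ≡ 0 → product (map (λ p → p ^ e p) ps) ≡ 1
  sum-map≡0⇒product-pow≡1 [] _ = refl
  sum-map≡0⇒product-pow≡1 (p ∷ ps) sum≡0 with e p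
  ... | zero = trans (+-identityʳ _) (sum-map≡0⇒product-pow≡1 ps sum≡0)

  sum-map≤1⇒product-pow≡1⊎prime : ∀ {ps} → All Prime ps → sum (map e ps) ≤ 1 →
    product (map (λ p → p ^ e p) ps) ≡ 1 ⊎ Prime (product (map (λ p → p ^ e p) ps))
  sum-map≤1⇒product-pow≡1⊎prime [] _ = inj₁ refl
  sum-map≤1⇒product-pow≡1⊎prime {p ∷ ps} (p-prime ∷ ps-prime) sum≤1 with e p
  ... | zero = ⊎-map (trans (+-identityʳ _)) (subst Prime (sym (+-identityʳ _)))
                     (sum-map≤1⇒product-pow≡1⊎prime ps-prime sum≤1)
  ... | suc zero = inj₂ (subst Prime (sym p^1*rest≡p) p-prime)
    where
    p^1*rest≡p : p * 1 * product (map (λ p → p ^ e p) ps) ≡ p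
    p^1*rest≡p = begin
      p * 1 * product (map (λ p → p ^ e p) ps) ≡⟨ cong (p * 1 *_) rest≡1 ⟩
      p * 1 * 1                                ≡⟨ *-identityʳ (p * 1) ⟩
      p * 1                                    ≡⟨ *-identityʳ p ⟩
      p                                        ∎
      where
      open ≡-Reasoning
      rest≡1 = sum-map≡0⇒product-pow≡1 ps (n≤0⇒n≡0 (≤-pred sum≤1))
  ... | suc (suc _) with s≤s () ← sum≤1

≡1⊎prime⊎prime*prime∣ : ∀ m .{{_ : NonZero m}} →
  m ≡ 1 ⊎ Prime m ⊎ ∃₂ λ p r → Prime p × Prime r × p * r ∣ m
≡1⊎prime⊎prime*prime∣ m with factorise m
... | record { factors = [] ; isFactorisation = m≡1 } = inj₁ m≡1
... | record { factors = p ∷ [] ; isFactorisation = m≡p*1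
             ; factorsPrime = p-prime ∷ [] } =
  inj₂ (inj₁ (subst Prime (sym (trans m≡p*1 (*-identityʳ p))) p-prime))
... | record { factors = p ∷ r ∷ rest ; isFactorisation = m≡p*r*rest
             ; factorsPrime = p-prime ∷ r-prime ∷ _ } =
  inj₂ (inj₂ (p , r , p-prime , r-prime , subst (p * r ∣_) (sym m≡p*r*rest) p*r∣p*[r*rest]))
  where
  p*r∣p*[r*rest] : p * r ∣ p * (r * product rest)
  p*r∣p*[r*rest] = *-monoʳ-∣ p (m∣m*n (product rest))

prime∣b⇒∈primesUpTo : ∀ k {p} → Prime p → p ∣ b (2 + k) → p ∈ primesUpTo (2 + k)
prime∣b⇒∈primesUpTo k p-prime p∣b = ∈-primesUpTo⁺ p-prime (∣⇒≤ (∣-trans p∣b (b∣n k)))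

prime*prime∣b⇒2≤sumδ1 : ∀ k {p r} → Prime p → Prime r → p * r ∣ b (2 + k) → 2 ≤ sumδ1 (2 + k)
prime*prime∣b⇒2≤sumδ1 k {p} {r} p-prime r-prime p*r∣b = by-cases (p ≟ r)
  where
  δ : ℕ → ℕ
  δ q = δ1 q (2 + k)
  p∣b = m*n∣⇒m∣ p r p*r∣b
  r∣b = m*n∣⇒n∣ p r p*r∣b
  p∈ = prime∣b⇒∈primesUpTo k p-prime p∣b
  r∈ = prime∣b⇒∈primesUpTo k r-prime r∣b
  1≤δ : ∀ {q} → Prime q → q ∣ b (2 + k) → 1 ≤ δ q
  1≤δ {q} q-prime q∣b = p^c∣b⇒c≤δ1 k 1 {{prime⇒nonTrivial q-prime}}
    (subst (_∣ b (2 + k)) (sym (*-identityʳ q)) q∣b)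
  by-cases : Dec (p ≡ r) → 2 ≤ sumδ1 (2 + k)
  by-cases (yes refl) = ≤-trans (p^c∣b⇒c≤δ1 k 2 {{prime⇒nonTrivial p-prime}} p^2∣b) (∈⇒≤sum-map δ p∈)
    where
    p^2∣b : p ^ 2 ∣ b (2 + k)
    p^2∣b = subst (_∣ b (2 + k)) (cong (p *_) (sym (*-identityʳ p))) p*r∣b
  by-cases (no p≢r) = ≤-trans (+-mono-≤ (1≤δ p-prime p∣b) (1≤δ r-prime r∣b))
                              (∈∧∈∧≢⇒+≤sum-map δ p∈ r∈ p≢r)

theorem4p9 : (n : ℕ) → 2 ≤ n → sumδ1 n ≤ 1 →
    (B1 n ≡ 1 ⊎ Prime (B1 n)) × (b n ≡ 1 ⊎ Prime (b n))
theorem4p9 n@(suc (suc k)) (s≤s (s≤s z≤n)) sumδ1≤1 = B1≡1⊎prime , b≡1⊎prime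
  where
  B1≡1⊎prime : B1 n ≡ 1 ⊎ Prime (B1 n)
  B1≡1⊎prime =
    sum-map≤1⇒product-pow≡1⊎prime (λ p → δ1 p n) (all-filter prime? (upTo (suc n))) sumδ1≤1
  b≡1⊎prime : b n ≡ 1 ⊎ Prime (b n)
  b≡1⊎prime with ≡1⊎prime⊎prime*prime∣ (b n) {{b-nonZero k}}
  ... | inj₁ b≡1 = inj₁ b≡1
  ... | inj₂ (inj₁ b-is-prime) = inj₂ b-is-prime
  ... | inj₂ (inj₂ (_ , _ , p-prime , r-prime , p*r∣b)) =
    ⊥-elim (<⇒≱ (prime*prime∣b⇒2≤sumδ1 k p-prime r-prime p*r∣b) sumδ1≤1)
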